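{- Let $\mathcal{P}$ be the class of all finite structures $X=(A,S,T)$, with $S,T\subseteq A\times A$ binary relations, such that: (1) the directed graph $(A,S\cup T)$ is a directed forest; (2) $S\cap T=\emptyset$; (3) for every $w\in A$, the set of edges $(v,w)\in S\cup T$ with target $w$ is contained entirely in $S$ or entirely in $T$. Then $\mathcal{P}$ has the weak amalgamation property.
   Context: A directed graph $(A,R)$ with $R\subseteq A\times A$ is a directed forest if $R$ is antisymmetric (if $(v,w)\in R$ then $(w,v)\notin R$), irreflexive, and the undirected graph on $A$ with edge set $\{\{v,w\}:(v,w)\in R\}$ is acyclic. Embeddings between $\{S,T\}$-structures are injective maps preserving and reflecting both relations. A class $\mathcal{F}$ of finite structures has the weak amalgamation property (WAP) if for every $Z\in\mathcal{F}$ there is $Z'\in\mathcal{F}$ containing $Z$ as a substructure such that for all embeddings $f\colon Z'\to X$, $g\colon Z'\to Y$ with $X,Y\in\mathcal{F}$ there exist $W\in\mathcal{F}$ and embeddings $f'\colon X\to W$, $g'\colon Y\to W$ with $f'\circ f\restriction Z=g'\circ g\restriction Z$. -}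

module Defs where

open import Data.Nat using (ℕ; _≥_)
open import Data.Fin using (Fin)
open import Data.Bool using (Bool; true; false)
open import Data.List using (List; length; head; last)
open import Data.List.Relation.Unary.Unique.Propositional using (Unique)
open import Data.List.Relation.Unary.Linked using (Linked)
open import Data.Maybe using (just)
open import Data.Product using (Σ; _×_; ∃; ∃-syntax; _,_)
open import Data.Sum using (_⊎_)
open import Relation.Binary.PropositionalEquality using (_≡_)
open import Relation.Nullary using (¬_)
open import Function using (_∘_)
open import Function.Definitions using (Injective)

record Structure : Set where
  field
    size : ℕ
    S : Fin size → Fin size → Bool
    T : Fin size → Fin size → Bool
open Structure public

Edge : (X : Structure) → Fin (size X) → Fin (size X) → Set
Edge X v w = (S X v w ≡ true) ⊎ (T X v w ≡ true)

Adj : (X : Structure) → Fin (size X) → Fin (size X) → Set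
Adj X v w = Edge X v w ⊎ Edge X w v

IsCycle : (X : Structure) → List (Fin (size X)) → Set
IsCycle X vs =
  (length vs ≥ 3) × Unique vs × Linked (Adj X) vs ×
  (∀ a b → head vs ≡ just a → last vs ≡ just b → Adj X b a)

DirectedForest : Structure → Set
DirectedForest X =
  (∀ v → ¬ Edge X v v) ×
  (∀ v w → Edge X v w → ¬ Edge X w v) ×
  (∀ vs → ¬ IsCycle X vs)

InP : Structure → Set
InP X =
  DirectedForest X ×
  (∀ v w → ¬ ((S X v w ≡ true) × (T X v w ≡ true))) ×
  (∀ w → (∀ v → Edge X v w → S X v w ≡ true) ⊎ (∀ v → Edge X v w → T X v w ≡ true))

record Embedding (X Y : Structure) : Set where
  field
    fun : Fin (size X) → Fin (size Y)
    inj : Injective _≡_ _≡_ fun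
    presS : ∀ a b → S Y (fun a) (fun b) ≡ S X a b
    presT : ∀ a b → T Y (fun a) (fun b) ≡ T X a b
open Embedding public

WAP : (Structure → Set) → Set
WAP F =
  ∀ (Z : Structure) → F Z →
  Σ Structure λ Z' → F Z' × Σ (Embedding Z Z') λ e →
    ∀ (X Y : Structure) → F X → F Y →
    (f : Embedding Z' X) (g : Embedding Z' Y) →
    Σ Structure λ W → F W × Σ (Embedding X W) λ f' → Σ (Embedding Y W) λ g' →
      ∀ z → fun f' (fun f (fun e z)) ≡ fun g' (fun g (fun e z))

-- A structure in 𝒫 is a directed forest whose vertices carry a colour: the edges into a vertex lie in S
-- or in T according to the colour of their target. Given Z, let Z′ add a new vertex with an edge into
-- each vertex of Z, a hub with an edge into one chosen vertex of each connected component of Z, and a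
-- root with an edge into the hub. The core (Z together with the hub) is then connected in Z′, and every
-- core vertex has an in-edge in Z′, which forces its colour in any extension of Z′. Given embeddings of
-- Z′ into X and Y, glue X and Y along the images of the core. The colours agree on the glued vertices, so
-- only acyclicity needs an argument: a cycle meeting both X ∖ Y and Y ∖ X contains a run of Y-only
-- vertices between two distinct core vertices, and closing that run up with the path joining them inside
-- the core gives a cycle in Y.
module Submission where

open import Defs

open import Data.Bool as Bool using (Bool; true; false; _∧_; not)
open import Data.Bool.Properties using (¬-not; ∧-conicalˡ)
open import Data.Empty using (⊥; ⊥-elim)
open import Data.Fin as Fin using (Fin; zero; suc; toℕ; fromℕ<)
open import Data.Fin.Properties as Finₚ
  using (pigeonhole; any?; ¬∀⟶∃¬-smallest; toℕ-injective; toℕ-inject; toℕ-fromℕ<)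
open import Data.List using (List; []; _∷_; _++_; length; map; head; last; lookup)
open import Data.List.Properties using (length-++; length-map)
open import Data.List.Membership.Propositional using (_∈_; _∉_; find; lose)
open import Data.List.Membership.Propositional.Properties using (∈-++⁺ˡ; ∈-++⁻; ∈-lookup; ∈-map⁻)
open import Data.List.Relation.Binary.Disjoint.Propositional using (Disjoint)
open import Data.List.Relation.Binary.Permutation.Propositional using (_↭_; ↭-sym; ↭-trans; ↭-refl; ↭⇒↭ₛ)
open import Data.List.Relation.Binary.Permutation.Propositional.Properties
  using (++-comm; ↭-length; Any-resp-↭; ∈-resp-↭)
import Data.List.Relation.Binary.Permutation.Setoid.Properties as PermutationSetoid
open import Data.List.Relation.Binary.Subset.Propositional using (_⊆_)
open import Data.List.Relation.Unary.All as All using (All; []; _∷_)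
open import Data.List.Relation.Unary.All.Properties as Allₚ using (¬All⇒Any¬)
open import Data.List.Relation.Unary.Any as Any using (Any; here; there)
open import Data.List.Relation.Unary.Linked using (Linked; [-]; _∷_)
open import Data.List.Relation.Unary.Unique.Propositional using (Unique; []; _∷_)
import Data.List.Relation.Unary.Unique.Propositional.Properties as Unique
open import Data.Maybe using (just)
open import Data.Nat using (ℕ; zero; suc; _+_; _≤_; z≤n; s≤s)
import Data.Nat.Properties as ℕ
open import Data.Product using (Σ; ∃; ∃₂; _×_; _,_; proj₁; proj₂)
open import Data.Sum as Sum using (_⊎_; inj₁; inj₂; [_,_]′)
import Data.Sum.Properties as Sumₚ
open import Function using (_∘_; id; const)
open import Function.Bundles using (_↔_; _⇔_; Inverse; Equivalence; mk↔ₛ′; mk⇔)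
open import Relation.Binary.Construct.Closure.ReflexiveTransitive
  using (Star; ε; _◅_; _◅◅_; gmap; reverse; revApp)
open import Relation.Binary.Definitions using (DecidableEquality)
open import Relation.Binary.PropositionalEquality
  using (_≡_; _≢_; refl; sym; trans; cong; cong₂; subst; subst₂; setoid)
open import Relation.Nullary using (¬_; Dec; yes; no; does; contradiction)
open import Relation.Nullary.Decidable as Dec
  using (_⊎-dec_; _×-dec_; ¬?; dec-true; decidable-stable)
open import Relation.Unary using (Decidable)

-- Walks and cycles

Unique-resp-↭ : ∀ {V : Set} {xs ys : List V} → xs ↭ ys → Unique xs → Unique ys
Unique-resp-↭ {V} p = PermutationSetoid.Unique-resp-↭ (setoid V) (↭⇒↭ₛ p)

module Walks {V : Set} (A : V → V → Set) where

  mutual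
    vertices : ∀ {a b} → Star A a b → List V
    vertices {a} w = a ∷ steps w

    steps : ∀ {a b} → Star A a b → List V
    steps ε       = []
    steps (e ◅ w) = vertices w

  len : ∀ {a b} → Star A a b → ℕ
  len w = length (steps w)

  steps-◅◅ : ∀ {a b c} (w₁ : Star A a b) (w₂ : Star A b c) →
             steps (w₁ ◅◅ w₂) ≡ steps w₁ ++ steps w₂
  steps-◅◅ ε        w₂ = refl
  steps-◅◅ (e ◅ w₁) w₂ = cong (_ ∷_) (steps-◅◅ w₁ w₂)

  vertices-◅◅◅ : ∀ {a b c d} (w₁ : Star A a b) (e : A b c) (w₂ : Star A c d) →
                 vertices (w₁ ◅◅ (e ◅ w₂)) ≡ vertices w₁ ++ vertices w₂
  vertices-◅◅◅ w₁ e w₂ = cong (_ ∷_) (steps-◅◅ w₁ (e ◅ w₂))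

  steps-rotate : ∀ {a b} (w₁ : Star A a b) (w₂ : Star A b a) →
                 steps (w₂ ◅◅ w₁) ↭ steps (w₁ ◅◅ w₂)
  steps-rotate w₁ w₂ rewrite steps-◅◅ w₂ w₁ | steps-◅◅ w₁ w₂ = ++-comm (steps w₂) (steps w₁)

  end∈ : ∀ {a b} (w : Star A a b) → b ∈ vertices w
  end∈ ε       = here refl
  end∈ (e ◅ w) = there (end∈ w)

  last-vertices : ∀ {a b} (w : Star A a b) → last (vertices w) ≡ just b
  last-vertices ε           = refl
  last-vertices (e ◅ ε)     = refl
  last-vertices (e ◅ f ◅ w) = last-vertices (f ◅ w)

  ∈-◅◅ˡ : ∀ {a b c z} (w₁ : Star A a b) {w₂ : Star A b c} →
          z ∈ vertices w₁ → z ∈ vertices (w₁ ◅◅ w₂)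
  ∈-◅◅ˡ ε        (here refl) = here refl
  ∈-◅◅ˡ (e ◅ w₁) (here refl) = here refl
  ∈-◅◅ˡ (e ◅ w₁) (there m)   = there (∈-◅◅ˡ w₁ m)

  ∈-◅◅ʳ : ∀ {a b c z} (w₁ : Star A a b) {w₂ : Star A b c} →
          z ∈ vertices w₂ → z ∈ vertices (w₁ ◅◅ w₂)
  ∈-◅◅ʳ ε        m = m
  ∈-◅◅ʳ (e ◅ w₁) m = there (∈-◅◅ʳ w₁ m)

  All-◅◅ : ∀ {P : V → Set} {a b c} (w₁ : Star A a b) {w₂ : Star A b c} →
           All P (vertices w₁) → All P (vertices w₂) → All P (vertices (w₁ ◅◅ w₂))
  All-◅◅ ε        _          p₂ = p₂
  All-◅◅ (e ◅ w₁) (pa ∷ p₁) p₂ = pa ∷ All-◅◅ w₁ p₁ p₂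

  split : ∀ {a b y} (w : Star A a b) → y ∈ vertices w →
          ∃₂ λ (w₁ : Star A a y) (w₂ : Star A y b) → w ≡ w₁ ◅◅ w₂
  split w       (here refl) = ε , w , refl
  split (e ◅ w) (there m)   with split w m
  ... | w₁ , w₂ , refl = e ◅ w₁ , w₂ , refl

  unsnoc : ∀ {a b c} (e : A a b) (w : Star A b c) →
           ∃ λ p → Σ (Star A a p) λ w′ → Σ (A p c) λ l → e ◅ w ≡ w′ ◅◅ (l ◅ ε)
  unsnoc e ε       = _ , ε , e , refl
  unsnoc e (f ◅ w) with unsnoc f w
  ... | p , w′ , l , eq = p , e ◅ w′ , l , cong (e ◅_) eq

  Unique-◅◅ˡ : ∀ {a b c} (w₁ : Star A a b) (w₂ : Star A b c) →
               Unique (vertices (w₁ ◅◅ w₂)) → Unique (vertices w₁)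
  Unique-◅◅ˡ ε        w₂ _        = [] ∷ []
  Unique-◅◅ˡ (e ◅ w₁) w₂ (a∉ ∷ u) =
    All.tabulate (λ m → All.lookup a∉ (∈-◅◅ˡ w₁ m)) ∷ Unique-◅◅ˡ w₁ w₂ u

  Unique-◅◅ʳ : ∀ {a b c} (w₁ : Star A a b) (w₂ : Star A b c) →
               Unique (vertices (w₁ ◅◅ w₂)) → Unique (vertices w₂)
  Unique-◅◅ʳ ε        w₂ u       = u
  Unique-◅◅ʳ (e ◅ w₁) w₂ (_ ∷ u) = Unique-◅◅ʳ w₁ w₂ u

  Unique-◅◅-disjoint : ∀ {a b c d z} (w₁ : Star A a b) {e : A b c} {w₂ : Star A c d} →
                       Unique (vertices (w₁ ◅◅ (e ◅ w₂))) → z ∈ vertices w₁ → z ∉ vertices w₂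
  Unique-◅◅-disjoint ε        (b∉ ∷ _) (here refl) m = All.lookup b∉ m refl
  Unique-◅◅-disjoint (f ◅ w₁) (a∉ ∷ _) (here refl) m = All.lookup a∉ (∈-◅◅ʳ w₁ (there m)) refl
  Unique-◅◅-disjoint (f ◅ w₁) (_ ∷ u)  (there m₁)  m = Unique-◅◅-disjoint w₁ u m₁ m

  start≢end : ∀ {a b} (w : Star A a b) → Unique (vertices w) → 1 ≤ len w → a ≢ b
  start≢end (e ◅ w) (a∉ ∷ _) _ refl = All.lookup a∉ (end∈ w) refl

  firstExit : ∀ {P : V → Set} → Decidable P → ∀ {a b} (w : Star A a b) → P a →
              Any (¬_ ∘ P) (vertices w) →
              ∃₂ λ k y → Σ (Star A a k) λ w₁ → Σ (A k y) λ e → Σ (Star A y b) λ w₂ →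
                w ≡ w₁ ◅◅ (e ◅ w₂) × All P (vertices w₁) × ¬ P y
  firstExit P? ε       pa (here ¬pa) = ⊥-elim (¬pa pa)
  firstExit P? (_◅_ {j = c} e w) pa exit with P? c | exit
  ... | no ¬pc | _         = _ , _ , ε , e , w , refl , pa ∷ [] , ¬pc
  ... | yes pc | here ¬pa  = ⊥-elim (¬pa pa)
  ... | yes pc | there out with firstExit P? w pc out
  ...   | k , y , w₁ , f , w₂ , refl , all₁ , ¬py = k , y , e ◅ w₁ , f , w₂ , refl , pa ∷ all₁ , ¬py

  shorten : DecidableEquality V → ∀ {a b} (w : Star A a b) →
            Σ (Star A a b) λ p → Unique (vertices p) × vertices p ⊆ vertices w
  shorten _≟_ ε = ε , [] ∷ [] , id
  shorten _≟_ {a} (e ◅ w) with shorten _≟_ w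
  ... | p , u , p⊆w with Any.any? (a ≟_) (vertices p)
  ...   | no a∉p = e ◅ p , All.tabulate (λ m eq → a∉p (Any.map (trans eq) m)) ∷ u , sub
    where
    sub : vertices (e ◅ p) ⊆ vertices (e ◅ w)
    sub (here eq) = here eq
    sub (there m) = there (p⊆w m)
  ...   | yes a∈p with split p a∈p
  ...     | _ , p₂ , refl = p₂ , Unique-◅◅ʳ _ p₂ u , λ m → there (p⊆w (∈-◅◅ʳ _ m))

  -- The cycle start → next → ⋯ → start; members lists each of its vertices once, ending with start.
  record Cycle : Set where
    constructor cycle
    field
      {start next} : V
      out    : A start next
      back   : Star A next start
      unique : Unique (vertices back)
      long   : 2 ≤ len back

    members : List V
    members = vertices back

    closedWalk : Star A start start
    closedWalk = out ◅ back

  open Cycle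

  cycle-↭ : ∀ {y z} (c : Cycle) (e : A y z) (r : Star A z y) → vertices r ↭ members c → Cycle
  cycle-↭ c e r p =
    cycle e r (Unique-resp-↭ (↭-sym p) (unique c))
      (subst (2 ≤_) (sym (ℕ.suc-injective (↭-length p))) (long c))

  rotation-↭ : ∀ {y z} (c : Cycle) (w₁ : Star A (start c) y) (e : A y z) (w₂ : Star A z (start c)) →
               closedWalk c ≡ w₁ ◅◅ (e ◅ w₂) → vertices (w₂ ◅◅ w₁) ↭ members c
  rotation-↭ c w₁ e w₂ eq =
    subst (λ w → steps ((e ◅ w₂) ◅◅ w₁) ↭ steps w) (sym eq) (steps-rotate w₁ (e ◅ w₂))

  rotate : ∀ {y} (c : Cycle) → y ∈ members c → Σ Cycle λ c′ → start c′ ≡ y × members c′ ↭ members c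
  rotate c m with split (closedWalk c) (there m)
  ... | w₁ , ε      , _  = c , refl , ↭-refl
  ... | w₁ , e ◅ w₂ , eq = cycle-↭ c e (w₂ ◅◅ w₁) (rotation-↭ c w₁ e w₂ eq) , refl , rotation-↭ c w₁ e w₂ eq

  boundary : ∀ {P : V → Set} → Decidable P → (c : Cycle) → ∀ {o} → o ∈ members c → P o →
             Any (¬_ ∘ P) (members c) →
             Σ Cycle λ c′ → P (start c′) × ¬ P (next c′) × members c′ ↭ members c
  boundary P? c o∈ po exit with rotate c o∈
  ... | c₁ , refl , p₁ with firstExit P? (closedWalk c₁) po (there (Any-resp-↭ (↭-sym p₁) exit))
  ...   | k , y , w₁ , e , w₂ , eq , all₁ , ¬py =
    cycle-↭ c₁ e (w₂ ◅◅ w₁) (rotation-↭ c₁ w₁ e w₂ eq) , All.lookup all₁ (end∈ w₁) , ¬py ,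
    ↭-trans (rotation-↭ c₁ w₁ e w₂ eq) p₁

  cutAtStart : (c : Cycle) →
               ∃ λ p → Σ (Star A (next c) p) λ w → A p (start c) ×
                 members c ≡ vertices w ++ start c ∷ [] × Unique (vertices w) × start c ∉ vertices w ×
                 1 ≤ len w
  cutAtStart (cycle out ε           u ())
  cutAtStart (cycle out (f ◅ ε)     u (s≤s ()))
  cutAtStart (cycle out (f ◅ g ◅ r) u _) with unsnoc g r
  ... | p , w , l , eq =
    p , f ◅ w , l , trans (cong (vertices ∘ (f ◅_)) eq) (vertices-◅◅◅ (f ◅ w) l ε) ,
    Unique-◅◅ˡ (f ◅ w) (l ◅ ε) u′ , (λ m → Unique-◅◅-disjoint (f ◅ w) u′ m (here refl)) , s≤s z≤n
    where
    u′ : Unique (vertices ((f ◅ w) ◅◅ (l ◅ ε)))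
    u′ = subst (Unique ∘ vertices ∘ (f ◅_)) eq u

  neighbours : ∀ {y} (c : Cycle) → y ∈ members c → ∃₂ λ a b → A y a × A b y × a ≢ b
  neighbours c m with rotate c m
  ... | c′ , refl , _ with cutAtStart c′
  ...   | p , w , l , _ , u , _ , 1≤w = next c′ , p , out c′ , l , start≢end w u 1≤w

  join : ∀ {a b c d} (w₁ : Star A a b) (e : A b c) (w₂ : Star A c d) (e′ : A d a) →
         Unique (vertices w₁) → Unique (vertices w₂) → Disjoint (vertices w₁) (vertices w₂) →
         c ≢ d → Cycle
  join w₁ e ε        e′ _  _  _    c≢d = ⊥-elim (c≢d refl)
  join w₁ e (f ◅ w₂) e′ u₁ u₂ disj _   =
    cycle e′ (w₁ ◅◅ (e ◅ f ◅ w₂))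
      (subst Unique (sym (vertices-◅◅◅ w₁ e (f ◅ w₂))) (Unique.++⁺ u₁ u₂ disj))
      (subst (2 ≤_) (sym len≡) (ℕ.≤-trans (s≤s (s≤s z≤n)) (ℕ.m≤n+m _ (len w₁))))
    where
    len≡ : len (w₁ ◅◅ (e ◅ f ◅ w₂)) ≡ len w₁ + length (vertices (f ◅ w₂))
    len≡ = trans (cong length (steps-◅◅ w₁ (e ◅ f ◅ w₂))) (length-++ (steps w₁))

open Walks public
open Cycle public

module _ {V : Set} {A : V → V → Set} {P : V → Set} (A-sym : ∀ {a b} → A a b → A b a) where

  All-revApp : ∀ {a b c} (w : Star A b a) (acc : Star A b c) → All P (vertices A w) →
               All P (vertices A acc) → All P (vertices A (revApp A-sym w acc))
  All-revApp ε       acc _         pacc = pacc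
  All-revApp (e ◅ w) acc (_ ∷ pw) pacc = All-revApp w (A-sym e ◅ acc) pw (All.head pw ∷ pacc)

  All-reverse : ∀ {a b} (w : Star A a b) → All P (vertices A w) → All P (vertices A (reverse A-sym w))
  All-reverse w pw = All-revApp w ε pw (All.head pw ∷ [])

Image : ∀ {V W : Set} → (W → V) → V → Set
Image ι v = ∃ λ x → ι x ≡ v

module _ {V W : Set} {A : V → V → Set} {B : W → W → Set} where

  steps-gmap : ∀ (h : V → W) (hom : ∀ {x y} → A x y → B (h x) (h y)) {a b} (w : Star A a b) →
               steps B (gmap h hom w) ≡ map h (steps A w)
  steps-gmap h hom ε       = refl
  steps-gmap h hom (e ◅ w) = cong (h _ ∷_) (steps-gmap h hom w)

  mapCycle : (h : V → W) → (∀ {x y} → h x ≡ h y → x ≡ y) →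
             (∀ {x y} → A x y → B (h x) (h y)) → Cycle A → Cycle B
  mapCycle h inj hom (cycle out back u l) =
    cycle (hom out) (gmap h hom back)
      (subst Unique (sym (cong (h _ ∷_) (steps-gmap h hom back))) (Unique.map⁺ inj u))
      (subst (2 ≤_) (sym (trans (cong length (steps-gmap h hom back)) (length-map h (steps A back)))) l)

  module _ (ι : W → V) (reflect : ∀ {x y} → A (ι x) (ι y) → B x y) where

    lift : ∀ {a b} (w : Star A a b) → All (Image ι) (vertices A w) → ∀ {x} → ι x ≡ a →
           ∃ λ y → ι y ≡ b × Σ (Star B x y) λ w′ → map ι (vertices B w′) ≡ vertices A w
    lift ε       _         {x} refl = x , refl , ε , refl
    lift (e ◅ w) (_ ∷ all) {x} refl with All.head all
    ... | x₂ , refl with lift w all refl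
    ...   | y , eqy , w′ , eqv = y , eqy , reflect e ◅ w′ , cong (ι x ∷_) eqv

    liftCycle : (c : Cycle A) → All (Image ι) (members c) → Cycle B
    liftCycle (cycle out back u l) all with All.head all
    ... | x , refl with lift back all refl
    ...   | y , refl , back′ , eq =
      cycle (reflect out) back′ (Unique.map⁻ (subst Unique (sym eq) u))
        (subst (2 ≤_) (ℕ.suc-injective (trans (sym (cong length eq)) (length-map ι (vertices B back′)))) l)

-- Forests

module _ {V : Set} (E : V → V → Set) where

  Link : V → V → Set
  Link x y = E x y ⊎ E y x

  record IsForest : Set where
    field
      irreflexive : ∀ x → ¬ E x x
      asymmetric  : ∀ {x y} → E x y → ¬ E y x
      acyclic     : ¬ Cycle Link

open IsForest public

IsForest-pullback : ∀ {V W : Set} {E : V → V → Set} {F : W → W → Set} (h : V → W) →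
                    (∀ {x y} → h x ≡ h y → x ≡ y) → (∀ {x y} → E x y → F (h x) (h y)) →
                    IsForest F → IsForest E
IsForest-pullback h inj hom forest = record
  { irreflexive = λ x → irreflexive forest (h x) ∘ hom
  ; asymmetric  = λ e e′ → asymmetric forest (hom e) (hom e′)
  ; acyclic     = acyclic forest ∘ mapCycle h inj (Sum.map hom hom)
  }

module _ {V : Set} {A : V → V → Set} where

  linked : ∀ {a b} (w : Star A a b) → Linked A (vertices A w)
  linked ε       = [-]
  linked (e ◅ w) = e ∷ linked w

  fromLinked : ∀ a xs → Linked A (a ∷ xs) → ∃ λ b → Σ (Star A a b) λ w → vertices A w ≡ a ∷ xs
  fromLinked a []       _       = a , ε , refl
  fromLinked a (x ∷ xs) (e ∷ l) with fromLinked x xs l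
  ... | b , w , eq = b , e ◅ w , cong (a ∷_) eq

Cycle⇒IsCycle : (X : Structure) (c : Cycle (Adj X)) → IsCycle X (members c)
Cycle⇒IsCycle X c = s≤s (long c) , unique c , linked (back c) , closing
  where
  closing : ∀ a b → head (members c) ≡ just a → last (members c) ≡ just b → Adj X b a
  closing a b refl eq with trans (sym (last-vertices (Adj X) (back c))) eq
  ... | refl = out c

IsCycle⇒Cycle : (X : Structure) → ∀ {vs} → IsCycle X vs → Cycle (Adj X)
IsCycle⇒Cycle X {v ∷ rest} (s≤s l , u , lk , closing) with fromLinked v rest lk
... | b , w , eq =
  cycle (closing v b refl (trans (cong last (sym eq)) (last-vertices (Adj X) w))) w
    (subst Unique (sym eq) u) (subst (2 ≤_) (ℕ.suc-injective (cong length (sym eq))) l)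

DirectedForest⇒IsForest : (X : Structure) → DirectedForest X → IsForest (Edge X)
DirectedForest⇒IsForest X (irr , asym , noCycle) = record
  { irreflexive = irr
  ; asymmetric  = asym _ _
  ; acyclic     = λ c → noCycle _ (Cycle⇒IsCycle X c)
  }

IsForest⇒DirectedForest : (X : Structure) → IsForest (Edge X) → DirectedForest X
IsForest⇒DirectedForest X forest =
  irreflexive forest , (λ _ _ → asymmetric forest) , λ _ → acyclic forest ∘ IsCycle⇒Cycle X

-- Connected components of a finite graph

lookup-injective : ∀ {V : Set} {xs : List V} → Unique xs → ∀ {i j} → lookup xs i ≡ lookup xs j → i ≡ j
lookup-injective {xs = x ∷ xs} _        {zero}  {zero}  eq = refl
lookup-injective {xs = x ∷ xs} (x∉ ∷ _) {zero}  {suc j} eq =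
  contradiction eq (All.lookup x∉ (∈-lookup j))
lookup-injective {xs = x ∷ xs} (x∉ ∷ _) {suc i} {zero}  eq =
  contradiction (sym eq) (All.lookup x∉ (∈-lookup i))
lookup-injective {xs = x ∷ xs} (_ ∷ u)  {suc i} {suc j} eq = cong suc (lookup-injective u eq)

Unique⇒length≤ : ∀ {n} {xs : List (Fin n)} → Unique xs → length xs ≤ n
Unique⇒length≤ {n} {xs} u with length xs ℕ.≤? n
... | yes ok = ok
... | no ¬ok with pigeonhole (ℕ.≰⇒> ¬ok) (lookup xs)
...   | i , j , i<j , eq = contradiction (lookup-injective u eq) (Finₚ.<⇒≢ i<j)

least : ∀ {n} {P : Fin n → Set} → Decidable P → ∀ {i} → P i → ∃ λ j → P j × ∀ {k} → P k → j Fin.≤ k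
least {n} {P} P? {i} pi with ¬∀⟶∃¬-smallest n (¬_ ∘ P) (¬? ∘ P?) (λ none → none i pi)
... | j , ¬¬pj , below = j , decidable-stable (P? j) ¬¬pj , minimal
  where
  minimal : ∀ {k} → P k → j Fin.≤ k
  minimal {k} pk with toℕ k ℕ.<? toℕ j
  ... | no  k≮j = ℕ.≮⇒≥ k≮j
  ... | yes k<j = contradiction (subst P (sym (toℕ-injective (trans (toℕ-inject _) (toℕ-fromℕ< k<j)))) pk)
                                (below (fromℕ< k<j))

module Components {n : ℕ} {A : Fin n → Fin n → Set}
                  (A? : ∀ a b → Dec (A a b)) (A-sym : ∀ {a b} → A a b → A b a) where

  ShortWalk : ℕ → Fin n → Fin n → Set
  ShortWalk k a b = Σ (Star A a b) λ w → len A w ≤ k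

  shortWalk? : ∀ k a b → Dec (ShortWalk k a b)
  shortWalk? zero a b =
    Dec.map′ (λ { refl → ε , z≤n }) (λ { (ε , _) → refl ; (_ ◅ _ , ()) }) (a Fin.≟ b)
  shortWalk? (suc k) a b =
    Dec.map′ into outOf ((a Fin.≟ b) ⊎-dec any? λ c → A? a c ×-dec shortWalk? k c b)
    where
    into : a ≡ b ⊎ ∃ (λ c → A a c × ShortWalk k c b) → ShortWalk (suc k) a b
    into (inj₁ refl)               = ε , z≤n
    into (inj₂ (_ , e , w , len≤)) = e ◅ w , s≤s len≤
    outOf : ShortWalk (suc k) a b → a ≡ b ⊎ ∃ (λ c → A a c × ShortWalk k c b)
    outOf (ε , _)            = inj₁ refl
    outOf (e ◅ w , s≤s len≤) = inj₂ (_ , e , w , len≤)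

  reachable? : ∀ a b → Dec (Star A a b)
  reachable? a b = Dec.map′ proj₁ toShort (shortWalk? n a b)
    where
    toShort : Star A a b → ShortWalk n a b
    toShort w with shorten A Fin._≟_ w
    ... | p , u , _ = p , ℕ.<⇒≤ (Unique⇒length≤ u)

  private
    leastSource : ∀ v → ∃ λ r → Star A r v × ∀ {u} → Star A u v → r Fin.≤ u
    leastSource v = least (λ u → reachable? u v) ε

  representative : Fin n → Fin n
  representative v = proj₁ (leastSource v)

  representative-walk : ∀ v → Star A (representative v) v
  representative-walk v = proj₁ (proj₂ (leastSource v))

  representative-cong : ∀ {a b} → Star A a b → representative a ≡ representative b
  representative-cong {a} {b} w =
    Finₚ.≤-antisym (minimal a (representative-walk b ◅◅ reverse A-sym w))
                   (minimal b (representative-walk a ◅◅ w))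
    where
    minimal : ∀ v {u} → Star A u v → representative v Fin.≤ u
    minimal v = proj₂ (proj₂ (leastSource v))

-- Structures in 𝒫 as coloured forests

Edge? : (X : Structure) → ∀ a b → Dec (Edge X a b)
Edge? X a b = (S X a b Bool.≟ true) ⊎-dec (T X a b Bool.≟ true)

Edge-preserved : ∀ {X Y} (f : Embedding X Y) {a b} → Edge X a b → Edge Y (fun f a) (fun f b)
Edge-preserved f {a} {b} = Sum.map (trans (presS f a b)) (trans (presT f a b))

Edge-reflected : ∀ {X Y} (f : Embedding X Y) {a b} → Edge Y (fun f a) (fun f b) → Edge X a b
Edge-reflected f {a} {b} = Sum.map (trans (sym (presS f a b))) (trans (sym (presT f a b)))

Adj-preserved : ∀ {X Y} (f : Embedding X Y) {a b} → Adj X a b → Adj Y (fun f a) (fun f b)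
Adj-preserved f = Sum.map (Edge-preserved f) (Edge-preserved f)

-- true when the edges into the vertex lie in S (an arbitrary choice if there are none)
colour : (X : Structure) → InP X → Fin (size X) → Bool
colour X (_ , _ , inType) w = [ const true , const false ]′ (inType w)

module _ (X : Structure) (pX : InP X) where

  private
    disjoint : ∀ v w → ¬ ((S X v w ≡ true) × (T X v w ≡ true))
    disjoint = proj₁ (proj₂ pX)
    inType : ∀ w → (∀ v → Edge X v w → S X v w ≡ true) ⊎ (∀ v → Edge X v w → T X v w ≡ true)
    inType = proj₂ (proj₂ pX)

  colour-of-edge : ∀ {a b} → Edge X a b → colour X pX b ≡ S X a b
  colour-of-edge {a} {b} e with inType b
  ... | inj₁ allS = sym (allS a e)
  ... | inj₂ allT = sym (¬-not (λ s → disjoint a b (s , allT a e)))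

  S≡edge∧colour : ∀ {a b} (edge? : Dec (Edge X a b)) → S X a b ≡ does edge? ∧ colour X pX b
  S≡edge∧colour (yes e) = sym (colour-of-edge e)
  S≡edge∧colour (no ¬e) = ¬-not (¬e ∘ inj₁)

  T≡edge∧¬colour : ∀ {a b} (edge? : Dec (Edge X a b)) → T X a b ≡ does edge? ∧ not (colour X pX b)
  T≡edge∧¬colour (no ¬e) = ¬-not (¬e ∘ inj₂)
  T≡edge∧¬colour {a} {b} (yes e) rewrite colour-of-edge e with S X a b in s
  ... | true  = ¬-not (λ t → disjoint a b (s , t))
  ... | false = [ (λ ()) , id ]′ e

colour-preserved : ∀ {X Y} (pX : InP X) (pY : InP Y) (f : Embedding X Y) {z k} →
                   Edge X z k → colour Y pY (fun f k) ≡ colour X pX k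
colour-preserved {X} {Y} pX pY f {z} {k} e =
  trans (colour-of-edge Y pY (Edge-preserved f e)) (trans (presS f z k) (sym (colour-of-edge X pX e)))

∧-not-disjoint : ∀ x y → x ∧ y ≡ true → x ∧ not y ≡ true → ⊥
∧-not-disjoint true true _ ()

module Coloured {V : Set} {m : ℕ} (vertex : Fin m ↔ V) {Arc : V → V → Set}
                (arc? : ∀ x y → Dec (Arc x y)) (paint : V → Bool) where

  open Inverse vertex using (to; from; strictlyInverseˡ; strictlyInverseʳ)

  coloured : Structure
  coloured = record
    { size = m
    ; S    = λ a b → does (arc? (to a) (to b)) ∧ paint (to b)
    ; T    = λ a b → does (arc? (to a) (to b)) ∧ not (paint (to b))
    }

  to-injective : ∀ {a b} → to a ≡ to b → a ≡ b
  to-injective {a} {b} eq = trans (sym (strictlyInverseʳ a)) (trans (cong from eq) (strictlyInverseʳ b))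

  Edge⇒Arc : ∀ {a b} → Edge coloured a b → Arc (to a) (to b)
  Edge⇒Arc {a} {b} e = witness (arc? (to a) (to b)) ([ ∧-conicalˡ _ _ , ∧-conicalˡ _ _ ]′ e)
    where
    witness : ∀ {P : Set} (p? : Dec P) → does p? ≡ true → P
    witness (yes p) _ = p

  Arc⇒Edge : ∀ {a b} → Arc (to a) (to b) → Edge coloured a b
  Arc⇒Edge {a} {b} arc with paint (to b)
  ... | true  = inj₁ (cong (_∧ true) (dec-true (arc? (to a) (to b)) arc))
  ... | false = inj₂ (cong (_∧ true) (dec-true (arc? (to a) (to b)) arc))

  coloured-InP : IsForest Arc → InP coloured
  coloured-InP forest =
    IsForest⇒DirectedForest coloured (IsForest-pullback to to-injective Edge⇒Arc forest) ,
    (λ a b (s , t) → ∧-not-disjoint (does (arc? (to a) (to b))) (paint (to b)) s t) ,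
    inType
    where
    inType : ∀ w → (∀ v → Edge coloured v w → S coloured v w ≡ true) ⊎
                   (∀ v → Edge coloured v w → T coloured v w ≡ true)
    inType w = byPaint (paint (to w)) (λ v e → cong (_∧ paint (to w)) (arc≡true e))
                                      (λ v e → cong (_∧ not (paint (to w))) (arc≡true e))
      where
      arc≡true : ∀ {v} → Edge coloured v w → does (arc? (to v) (to w)) ≡ true
      arc≡true e = dec-true (arc? _ _) (Edge⇒Arc e)
      byPaint : ∀ c → (∀ v → Edge coloured v w → S coloured v w ≡ c) →
                (∀ v → Edge coloured v w → T coloured v w ≡ not c) →
                (∀ v → Edge coloured v w → S coloured v w ≡ true) ⊎
                (∀ v → Edge coloured v w → T coloured v w ≡ true)
      byPaint true  s _ = inj₁ s
      byPaint false _ t = inj₂ t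

  embedding : (X : Structure) (pX : InP X) (h : Fin (size X) → V) → (∀ {a b} → h a ≡ h b → a ≡ b) →
              (∀ {a b} → Arc (h a) (h b) ⇔ Edge X a b) → (∀ b → paint (h b) ≡ colour X pX b) →
              Embedding X coloured
  embedding X pX h h-injective arc⇔edge paint≡colour = record
    { fun   = from ∘ h
    ; inj   = h-injective ∘ from-injective
    ; presS = λ a b → trans (cong₂ _∧_ (arc≡ a b) (paint≡ b)) (sym (S≡edge∧colour X pX (edge? a b)))
    ; presT = λ a b → trans (cong₂ _∧_ (arc≡ a b) (cong not (paint≡ b)))
                            (sym (T≡edge∧¬colour X pX (edge? a b)))
    }
    where
    from-injective : ∀ {x y} → from x ≡ from y → x ≡ y
    from-injective {x} {y} eq = trans (sym (strictlyInverseˡ x)) (trans (cong to eq) (strictlyInverseˡ y))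
    edge? : ∀ a b → Dec (Edge X a b)
    edge? a b = Dec.map arc⇔edge (arc? (h a) (h b))
    arc≡ : ∀ a b → does (arc? (to (from (h a))) (to (from (h b)))) ≡ does (arc? (h a) (h b))
    arc≡ a b = cong₂ (λ x y → does (arc? x y)) (strictlyInverseˡ (h a)) (strictlyInverseˡ (h b))
    paint≡ : ∀ b → paint (to (from (h b))) ≡ colour X pX b
    paint≡ b = trans (cong paint (strictlyInverseˡ (h b))) (paint≡colour b)

-- The extension Z′ of Z

module Extension (Z : Structure) (pZ : InP Z) where

  private
    n : ℕ
    n = size Z

  data Vertex : Set where
    old leaf : Fin n → Vertex
    hub root : Vertex

  decode : Fin (2 + (n + n)) → Vertex
  decode zero          = root
  decode (suc zero)    = hub
  decode (suc (suc i)) = [ old , leaf ]′ (Fin.splitAt n i)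

  encode : Vertex → Fin (2 + (n + n))
  encode root     = zero
  encode hub      = suc zero
  encode (old a)  = suc (suc (a Fin.↑ˡ n))
  encode (leaf a) = suc (suc (n Fin.↑ʳ a))

  vertex : Fin (2 + (n + n)) ↔ Vertex
  vertex = mk↔ₛ′ decode encode decode-encode encode-decode
    where
    decode-encode : ∀ x → decode (encode x) ≡ x
    decode-encode root     = refl
    decode-encode hub      = refl
    decode-encode (old a)  = cong [ old , leaf ]′ (Finₚ.splitAt-↑ˡ n a n)
    decode-encode (leaf a) = cong [ old , leaf ]′ (Finₚ.splitAt-↑ʳ n n a)
    encode-join : ∀ s → encode ([ old , leaf ]′ s) ≡ suc (suc (Fin.join n n s))
    encode-join (inj₁ a) = refl
    encode-join (inj₂ a) = refl
    encode-decode : ∀ i → encode (decode i) ≡ i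
    encode-decode zero          = refl
    encode-decode (suc zero)    = refl
    encode-decode (suc (suc i)) =
      trans (encode-join (Fin.splitAt n i)) (cong (λ j → suc (suc j)) (Finₚ.join-splitAt n n i))

  open Components {A = Adj Z} (λ a b → Edge? Z a b ⊎-dec Edge? Z b a) Sum.swap

  data Arc : Vertex → Vertex → Set where
    oldArc  : ∀ {a b} → Edge Z a b → Arc (old a) (old b)
    leafArc : ∀ b → Arc (leaf b) (old b)
    hubArc  : ∀ {b} → representative b ≡ b → Arc hub (old b)
    rootArc : Arc root hub

  arc? : ∀ x y → Dec (Arc x y)
  arc? (old a)  (old b)  = Dec.map′ oldArc (λ { (oldArc e) → e }) (Edge? Z a b)
  arc? (leaf a) (old b)  = Dec.map′ (λ { refl → leafArc a }) (λ { (leafArc _) → refl }) (a Fin.≟ b)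
  arc? hub      (old b)  = Dec.map′ hubArc (λ { (hubArc r) → r }) (representative b Fin.≟ b)
  arc? root     (old b)  = no λ ()
  arc? root     hub      = yes rootArc
  arc? (old _)  hub      = no λ ()
  arc? (leaf _) hub      = no λ ()
  arc? hub      hub      = no λ ()
  arc? _        (leaf _) = no λ ()
  arc? _        root     = no λ ()

  Adjacent : Vertex → Vertex → Set
  Adjacent = Link Arc

  forestZ : IsForest (Edge Z)
  forestZ = DirectedForest⇒IsForest Z (proj₁ pZ)

  arc-irreflexive : ∀ x → ¬ Arc x x
  arc-irreflexive _ (oldArc e) = irreflexive forestZ _ e

  arc-asymmetric : ∀ {x y} → Arc x y → ¬ Arc y x
  arc-asymmetric (oldArc e) (oldArc e′) = asymmetric forestZ e e′

  not-on-cycle : ∀ {y t} (c : Cycle Adjacent) → y ∈ members c → (∀ {z} → Adjacent y z → z ≡ t) → ⊥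
  not-on-cycle c m only with neighbours Adjacent c m
  ... | a , b , ya , by , a≢b = a≢b (trans (only ya) (sym (only (Sum.swap by))))

  leaf-neighbour : ∀ {b z} → Adjacent (leaf b) z → z ≡ old b
  leaf-neighbour (inj₁ (leafArc b)) = refl

  root-neighbour : ∀ {z} → Adjacent root z → z ≡ hub
  root-neighbour (inj₁ rootArc) = refl

  hub-neighbour : ∀ {r} → Adjacent hub (old r) → representative r ≡ r
  hub-neighbour (inj₁ (hubArc isRepresentative)) = isRepresentative

  old-member : ∀ {x} (c : Cycle Adjacent) → x ∈ members c → x ≢ hub → Image old x
  old-member {old a}  c _ _   = a , refl
  old-member {leaf b} c m _   = ⊥-elim (not-on-cycle c m leaf-neighbour)
  old-member {root}   c m _   = ⊥-elim (not-on-cycle c m root-neighbour)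
  old-member {hub}    c _ h≢h = ⊥-elim (h≢h refl)

  reflectOld : ∀ {a b} → Adjacent (old a) (old b) → Adj Z a b
  reflectOld = Sum.map (λ { (oldArc e) → e }) (λ { (oldArc e) → e })

  hub-neighbours-coincide : ∀ {x y} → Adjacent hub x → Adjacent y hub → (w : Star Adjacent x y) →
                            All (Image old) (vertices Adjacent w) → x ≡ y
  hub-neighbours-coincide hx yh w allOld with All.head allOld | All.lookup allOld (end∈ Adjacent w)
  ... | r₁ , refl | r₂ , refl with lift old reflectOld w allOld refl
  ...   | _ , refl , wZ , _ =
    cong old (trans (sym (hub-neighbour hx)) (trans (representative-cong wZ) (hub-neighbour (Sum.swap yh))))

  hub-off-cycles : (c : Cycle Adjacent) → start c ≡ hub → ⊥
  hub-off-cycles c refl with cutAtStart Adjacent c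
  ... | p , w , l , members≡ , u , hub∉w , 1≤w =
    start≢end Adjacent w u 1≤w (hub-neighbours-coincide (out c) l w (All.tabulate old-on-w))
    where
    old-on-w : ∀ {z} → z ∈ vertices Adjacent w → Image old z
    old-on-w {z} m = old-member c (subst (z ∈_) (sym members≡) (∈-++⁺ˡ m)) (λ { refl → hub∉w m })

  hub? : ∀ x → Dec (hub ≡ x)
  hub? hub      = yes refl
  hub? (old _)  = no λ ()
  hub? (leaf _) = no λ ()
  hub? root     = no λ ()

  arc-acyclic : ¬ Cycle Adjacent
  arc-acyclic c with Any.any? hub? (members c)
  ... | yes hub∈ = let c′ , start≡hub , _ = rotate Adjacent c hub∈ in hub-off-cycles c′ start≡hub
  ... | no  hub∉ =
    acyclic forestZ (liftCycle old reflectOld c (All.tabulate λ m → old-member c m λ { refl → hub∉ m }))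

  arc-forest : IsForest Arc
  arc-forest = record
    { irreflexive = arc-irreflexive ; asymmetric = arc-asymmetric ; acyclic = arc-acyclic }

  paint : Vertex → Bool
  paint (old b) = colour Z pZ b
  paint _       = true

  open Coloured vertex arc? paint public using (to-injective; Arc⇒Edge) renaming (coloured to Z′)
  open Inverse vertex using (to; from; strictlyInverseˡ)

  Z′-InP : InP Z′
  Z′-InP = Coloured.coloured-InP vertex arc? paint arc-forest

  embed : Embedding Z Z′
  embed = Coloured.embedding vertex arc? paint Z pZ old (λ { refl → refl })
            (mk⇔ (λ { (oldArc e) → e }) oldArc) (λ _ → refl)

  data Core : Vertex → Set where
    oldCore : ∀ a → Core (old a)
    hubCore : Core hub

  core? : ∀ k → Dec (Core (to k))
  core? k = decide (to k)
    where
    decide : ∀ x → Dec (Core x)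
    decide (old a)  = yes (oldCore a)
    decide hub      = yes hubCore
    decide (leaf _) = no λ ()
    decide root     = no λ ()

  embed-core : ∀ z → Core (to (fun embed z))
  embed-core z = subst Core (sym (strictlyInverseˡ (old z))) (oldCore z)

  core-parent : ∀ {k} → Core (to k) → ∃ λ z → Edge Z′ z k
  core-parent {k} ck =
    from (parent ck) ,
    Arc⇒Edge {from (parent ck)} {k} (subst (λ v → Arc v (to k)) (sym (strictlyInverseˡ _)) (parentArc ck))
    where
    parent : ∀ {x} → Core x → Vertex
    parent (oldCore b) = leaf b
    parent hubCore     = root
    parentArc : ∀ {x} (cx : Core x) → Arc (parent cx) x
    parentArc (oldCore b) = leafArc b
    parentArc hubCore     = rootArc

  to-hub : ∀ {x} → Core x → Σ (Star Adjacent x hub) λ w → All Core (vertices Adjacent w)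
  to-hub hubCore     = ε , hubCore ∷ []
  to-hub (oldCore a) =
    toRepresentative ◅◅ (inj₂ (hubArc (representative-cong (representative-walk a))) ◅ ε) ,
    All-◅◅ Adjacent toRepresentative allOld (oldCore _ ∷ hubCore ∷ [])
    where
    toRepresentative : Star Adjacent (old a) (old (representative a))
    toRepresentative = gmap old (Sum.map oldArc oldArc) (reverse Sum.swap (representative-walk a))
    allOld : All Core (vertices Adjacent toRepresentative)
    allOld = subst (All Core) (sym (cong (old a ∷_) (steps-gmap old (Sum.map oldArc oldArc) _)))
                   (Allₚ.map⁺ (All.universal oldCore _))

  core-connected : ∀ {k k′} → Core (to k) → Core (to k′) →
                   Σ (Star (Adj Z′) k k′) λ w → All (Core ∘ to) (vertices (Adj Z′) w)
  core-connected {k} {k′} ck ck′ with to-hub ck | to-hub ck′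
  ... | w , all | w′ , all′
    with lift to (λ {x} {y} → Sum.map (Arc⇒Edge {x} {y}) (Arc⇒Edge {y} {x}))
              (w ◅◅ reverse Sum.swap w′) (All.universal (λ v → from v , strictlyInverseˡ v) _) refl
  ... | y , toy≡tok′ , wZ′ , eq with to-injective {y} {k′} toy≡tok′
  ...   | refl =
    wZ′ , Allₚ.map⁻ (subst (All Core) (sym eq) (All-◅◅ Adjacent w all (All-reverse Sum.swap w′ all′)))

-- Amalgamation over the core

module Amalgam (Z′ : Structure) (pZ′ : InP Z′) {Core : Fin (size Z′) → Set}
               (core? : ∀ k → Dec (Core k))
               (core-connected : ∀ {k k′} → Core k → Core k′ →
                                 Σ (Star (Adj Z′) k k′) λ w → All Core (vertices (Adj Z′) w))
               (core-parent : ∀ {k} → Core k → ∃ λ z → Edge Z′ z k)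
               {X Y : Structure} (pX : InP X) (pY : InP Y) (f : Embedding Z′ X) (g : Embedding Z′ Y) where

  Vertex : Set
  Vertex = Fin (size X) ⊎ Fin (size Y)

  _≟_ : DecidableEquality Vertex
  _≟_ = Sumₚ.≡-dec Fin._≟_ Fin._≟_

  InCore : Fin (size Y) → Set
  InCore y = ∃ λ k → Core k × fun g k ≡ y

  inCore? : ∀ y → Dec (InCore y)
  inCore? y = any? λ k → core? k ×-dec (fun g k Fin.≟ y)

  -- Every y gets a vertex inj₂ y, but for y in the core glue y lies in X, so inj₂ y stays isolated.
  glue : Fin (size Y) → Vertex
  glue y with inCore? y
  ... | yes (k , _) = inj₁ (fun f k)
  ... | no _        = inj₂ y

  glue-view : ∀ y → (∃ λ k → Core k × fun g k ≡ y × glue y ≡ inj₁ (fun f k)) ⊎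
                     (¬ InCore y × glue y ≡ inj₂ y)
  glue-view y with inCore? y
  ... | yes (k , ck , gk≡y) = inj₁ (k , ck , gk≡y , refl)
  ... | no ∉core            = inj₂ (∉core , refl)

  glue-core : ∀ {k} → Core k → glue (fun g k) ≡ inj₁ (fun f k)
  glue-core {k} ck with glue-view (fun g k)
  ... | inj₁ (k′ , _ , gk′≡gk , glued) = trans glued (cong (inj₁ ∘ fun f) (inj g gk′≡gk))
  ... | inj₂ (∉core , _)               = ⊥-elim (∉core (k , ck , refl))

  glue≡inj₁ : ∀ {y x} → glue y ≡ inj₁ x → ∃ λ k → Core k × fun g k ≡ y × fun f k ≡ x
  glue≡inj₁ {y} eq with glue-view y
  ... | inj₁ (k , ck , gk≡y , glued) = k , ck , gk≡y , Sumₚ.inj₁-injective (trans (sym glued) eq)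
  ... | inj₂ (_ , glued)             = contradiction (trans (sym glued) eq) λ ()

  glue-injective : ∀ {y y′} → glue y ≡ glue y′ → y ≡ y′
  glue-injective {y} {y′} eq with glue-view y | glue-view y′
  ... | inj₁ (k , _ , refl , glued) | inj₁ (k′ , _ , refl , glued′) =
    cong (fun g) (inj f (Sumₚ.inj₁-injective (trans (sym glued) (trans eq glued′))))
  ... | inj₂ (_ , glued) | inj₂ (_ , glued′) = Sumₚ.inj₂-injective (trans (sym glued) (trans eq glued′))
  ... | inj₁ (_ , _ , _ , glued) | inj₂ (_ , glued′) =
    contradiction (trans (sym glued) (trans eq glued′)) λ ()
  ... | inj₂ (_ , glued) | inj₁ (_ , _ , _ , glued′) =
    contradiction (trans (sym glued) (trans eq glued′)) λ ()

  data Arc (a b : Vertex) : Set where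
    inX : ∀ {x x′} → inj₁ x ≡ a → inj₁ x′ ≡ b → Edge X x x′ → Arc a b
    inY : ∀ {y y′} → glue y ≡ a → glue y′ ≡ b → Edge Y y y′ → Arc a b

  arc? : ∀ a b → Dec (Arc a b)
  arc? a b = Dec.map′ into outOf
    ((any? λ x → any? λ x′ → (inj₁ x ≟ a) ×-dec (inj₁ x′ ≟ b) ×-dec Edge? X x x′) ⊎-dec
     (any? λ y → any? λ y′ → (glue y ≟ a) ×-dec (glue y′ ≟ b) ×-dec Edge? Y y y′))
    where
    ArcData : Set
    ArcData = (∃₂ λ x x′ → inj₁ x ≡ a × inj₁ x′ ≡ b × Edge X x x′) ⊎
              (∃₂ λ y y′ → glue y ≡ a × glue y′ ≡ b × Edge Y y y′)
    into : ArcData → Arc a b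
    into (inj₁ (_ , _ , p , q , e)) = inX p q e
    into (inj₂ (_ , _ , p , q , e)) = inY p q e
    outOf : Arc a b → ArcData
    outOf (inX p q e) = inj₁ (_ , _ , p , q , e)
    outOf (inY p q e) = inj₂ (_ , _ , p , q , e)

  arc-inj₁⇔ : ∀ {x x′} → Arc (inj₁ x) (inj₁ x′) ⇔ Edge X x x′
  arc-inj₁⇔ = mk⇔ toX (inX refl refl)
    where
    toX : ∀ {x x′} → Arc (inj₁ x) (inj₁ x′) → Edge X x x′
    toX (inX refl refl e) = e
    toX (inY p q e) with glue≡inj₁ p | glue≡inj₁ q
    ... | k , _ , refl , refl | k′ , _ , refl , refl = Edge-preserved f (Edge-reflected g e)

  arc-glue⇔ : ∀ {y y′} → Arc (glue y) (glue y′) ⇔ Edge Y y y′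
  arc-glue⇔ = mk⇔ toY (inY refl refl)
    where
    toY : ∀ {y y′} → Arc (glue y) (glue y′) → Edge Y y y′
    toY (inY p q e) = subst₂ (Edge Y) (glue-injective p) (glue-injective q) e
    toY (inX p q e) with glue≡inj₁ (sym p) | glue≡inj₁ (sym q)
    ... | k , _ , refl , refl | k′ , _ , refl , refl = Edge-preserved g (Edge-reflected f e)

  forestX : IsForest (Edge X)
  forestX = DirectedForest⇒IsForest X (proj₁ pX)

  forestY : IsForest (Edge Y)
  forestY = DirectedForest⇒IsForest Y (proj₁ pY)

  arc-irreflexive : ∀ a → ¬ Arc a a
  arc-irreflexive _ arc@(inX _ refl _) = irreflexive forestX _ (Equivalence.to arc-inj₁⇔ arc)
  arc-irreflexive _ arc@(inY _ refl _) = irreflexive forestY _ (Equivalence.to arc-glue⇔ arc)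

  arc-asymmetric : ∀ {a b} → Arc a b → ¬ Arc b a
  arc-asymmetric (inX refl refl e) arc′ = asymmetric forestX e (Equivalence.to arc-inj₁⇔ arc′)
  arc-asymmetric (inY refl refl e) arc′ = asymmetric forestY e (Equivalence.to arc-glue⇔ arc′)

  Adjacent : Vertex → Vertex → Set
  Adjacent = Link Arc

  OnX OnY : Vertex → Set
  OnX = Image inj₁
  OnY = Image glue

  onX? : ∀ v → Dec (OnX v)
  onX? (inj₁ x) = yes (x , refl)
  onX? (inj₂ y) = no λ { (_ , ()) }

  onY? : ∀ v → Dec (OnY v)
  onY? v = any? λ y → glue y ≟ v

  link-sides : ∀ {a b} → Adjacent a b → (OnX a × OnX b) ⊎ (OnY a × OnY b)
  link-sides (inj₁ (inX p q _)) = inj₁ ((_ , p) , (_ , q))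
  link-sides (inj₁ (inY p q _)) = inj₂ ((_ , p) , (_ , q))
  link-sides (inj₂ (inX p q _)) = inj₁ ((_ , q) , (_ , p))
  link-sides (inj₂ (inY p q _)) = inj₂ ((_ , q) , (_ , p))

  link-to-Y-only : ∀ {a b} → Adjacent a b → ¬ OnX a ⊎ ¬ OnX b → OnY a × OnY b
  link-to-Y-only l ¬onX with link-sides l
  ... | inj₂ onY           = onY
  ... | inj₁ (onXa , onXb) = ⊥-elim ([ (λ ¬a → ¬a onXa) , (λ ¬b → ¬b onXb) ]′ ¬onX)

  reflectX : ∀ {x x′} → Adjacent (inj₁ x) (inj₁ x′) → Adj X x x′
  reflectX = Sum.map (Equivalence.to arc-inj₁⇔) (Equivalence.to arc-inj₁⇔)

  reflectY : ∀ {y y′} → Adjacent (glue y) (glue y′) → Adj Y y y′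
  reflectY = Sum.map (Equivalence.to arc-glue⇔) (Equivalence.to arc-glue⇔)

  member-side : ∀ {v} (c : Cycle Adjacent) → v ∈ members c → OnX v ⊎ OnY v
  member-side c m with neighbours Adjacent c m
  ... | _ , _ , l , _ = Sum.map proj₁ proj₁ (link-sides l)

  core-vertex : ∀ {v} → OnX v → OnY v → ∃ λ κ → Core κ × inj₁ (fun f κ) ≡ v × glue (fun g κ) ≡ v
  core-vertex (x , refl) (y , glued) with glue≡inj₁ glued
  ... | κ , cκ , refl , refl = κ , cκ , refl , glued

  bridge : ∀ {κ κ′ y₁ y₂} → Core κ → Core κ′ → κ ≢ κ′ → (u : Star (Adj Y) y₁ y₂) →
           Unique (vertices (Adj Y) u) → All (¬_ ∘ InCore) (vertices (Adj Y) u) →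
           Adj Y (fun g κ) y₁ → Adj Y y₂ (fun g κ′) → ⊥
  bridge {κ} {κ′} cκ cκ′ κ≢κ′ u u-unique u-outside e e′ with core-connected cκ′ cκ
  ... | w , w-core with shorten (Adj Z′) Fin._≟_ w
  ...   | p , p-unique , p⊆w =
    acyclic forestY (join (Adj Y) u e′ gp e u-unique
                      (subst Unique (sym gp-vertices) (Unique.map⁺ (inj g) p-unique))
                      disjoint (κ≢κ′ ∘ sym ∘ inj g))
    where
    gp : Star (Adj Y) (fun g κ′) (fun g κ)
    gp = gmap (fun g) (Adj-preserved g) p
    gp-vertices : vertices (Adj Y) gp ≡ map (fun g) (vertices (Adj Z′) p)
    gp-vertices = cong (fun g κ′ ∷_) (steps-gmap (fun g) (Adj-preserved g) p)
    disjoint : Disjoint (vertices (Adj Y) u) (vertices (Adj Y) gp)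
    disjoint {z} (z∈u , z∈gp) with ∈-map⁻ (fun g) (subst (z ∈_) gp-vertices z∈gp)
    ... | k , k∈p , refl = All.lookup u-outside z∈u (k , All.lookup w-core (p⊆w k∈p) , refl)

  no-Y-excursion : ∀ {k y p} → Adjacent k y → (w : Star Adjacent y p) → OnX k → ¬ OnX y →
               Unique (vertices Adjacent w) → k ∉ vertices Adjacent w →
               (∀ {v} → v ∈ vertices Adjacent w → OnX v ⊎ OnY v) →
               ∀ {o} → o ∈ vertices Adjacent w → OnX o → ⊥
  no-Y-excursion out w onXk ¬onXy u k∉w sides o∈w onXo
    with link-to-Y-only out (inj₂ ¬onXy)
       | firstExit Adjacent (¬? ∘ onX?) w ¬onXy (lose o∈w λ ¬onXo → ¬onXo onXo)
  ... | onYk , (y₁ , glue-y₁) | y′ , k′ , w₅ , e′ , w₆ , refl , w₅-Y-only , ¬¬onXk′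
    with core-vertex onXk onYk
       | core-vertex (decidable-stable (onX? k′) ¬¬onXk′)
                     (proj₂ (link-to-Y-only e′ (inj₁ (All.lookup w₅-Y-only (end∈ Adjacent w₅)))))
       | lift glue reflectY w₅ (All.tabulate onY-w₅) glue-y₁
    where
    onY-w₅ : ∀ {v} → v ∈ vertices Adjacent w₅ → OnY v
    onY-w₅ m = [ (λ onX → ⊥-elim (All.lookup w₅-Y-only m onX)) , id ]′ (sides (∈-◅◅ˡ Adjacent w₅ m))
  ... | κ , cκ , fκ≡k , gκ≡k | κ′ , cκ′ , fκ′≡k′ , gκ′≡k′ | y₂ , glue-y₂ , u₅ , u₅≡w₅ =
    bridge cκ cκ′ κ≢κ′ u₅
      (Unique.map⁻ (subst Unique (sym u₅≡w₅) (Unique-◅◅ˡ Adjacent w₅ (e′ ◅ w₆) u)))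
      (All.map (λ { ¬onX (k , ck , refl) → ¬onX (_ , sym (glue-core ck)) })
               (Allₚ.map⁻ (subst (All (¬_ ∘ OnX)) (sym u₅≡w₅) w₅-Y-only)))
      (reflectY (subst₂ Adjacent (sym gκ≡k) (sym glue-y₁) out))
      (reflectY (subst₂ Adjacent (sym glue-y₂) (sym gκ′≡k′) e′))
    where
    κ≢κ′ : κ ≢ κ′
    κ≢κ′ refl = k∉w (subst (_∈ vertices Adjacent (w₅ ◅◅ (e′ ◅ w₆))) (trans (sym fκ′≡k′) fκ≡k)
                            (∈-◅◅ʳ Adjacent w₅ (there (here refl))))

  no-Y-excursion-on-cycle : (c : Cycle Adjacent) → OnX (start c) → ¬ OnX (next c) →
                   ∀ {o} → o ∈ members c → ¬ OnY o → ⊥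
  no-Y-excursion-on-cycle c onXk ¬onXy {o} o∈ ¬onYo with member-side c o∈ | cutAtStart Adjacent c
  ... | inj₂ onYo | _ = ¬onYo onYo
  ... | inj₁ onXo | p , w , l , members≡ , u , k∉w , _ =
    no-Y-excursion (out c) w onXk ¬onXy u k∉w sides o∈w onXo
    where
    sides : ∀ {v} → v ∈ vertices Adjacent w → OnX v ⊎ OnY v
    sides {v} m = member-side c (subst (v ∈_) (sym members≡) (∈-++⁺ˡ m))
    o∈w : o ∈ vertices Adjacent w
    o∈w with ∈-++⁻ (vertices Adjacent w) (subst (o ∈_) members≡ o∈)
    ... | inj₁ m           = m
    ... | inj₂ (here refl) = ⊥-elim (¬onYo (proj₁ (link-to-Y-only (out c) (inj₂ ¬onXy))))

  arc-acyclic : ¬ Cycle Adjacent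
  arc-acyclic c with All.all? onX? (members c) | All.all? onY? (members c)
  ... | yes allX | _        = acyclic forestX (liftCycle inj₁ reflectX c allX)
  ... | no _     | yes allY = acyclic forestY (liftCycle glue reflectY c allY)
  ... | no notX  | no notY with find (¬All⇒Any¬ onY? _ notY)
  ...   | o , o∈ , ¬onYo with member-side c o∈
  ...     | inj₂ onYo = ¬onYo onYo
  ...     | inj₁ onXo with boundary Adjacent onX? c o∈ onXo (¬All⇒Any¬ onX? _ notX)
  ...       | c′ , onXk , ¬onXy , perm = no-Y-excursion-on-cycle c′ onXk ¬onXy (∈-resp-↭ (↭-sym perm) o∈) ¬onYo

  arc-forest : IsForest Arc
  arc-forest = record
    { irreflexive = arc-irreflexive ; asymmetric = arc-asymmetric ; acyclic = arc-acyclic }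

  paint : Vertex → Bool
  paint (inj₁ x) = colour X pX x
  paint (inj₂ y) = colour Y pY y

  open Coloured (Finₚ.+↔⊎ {size X} {size Y}) arc? paint public using () renaming (coloured to W)

  W-InP : InP W
  W-InP = Coloured.coloured-InP Finₚ.+↔⊎ arc? paint arc-forest

  -- A core vertex has an in-edge already in Z′, which fixes its colour in both X and Y.
  paint-glue : ∀ y → paint (glue y) ≡ colour Y pY y
  paint-glue y with glue-view y
  ... | inj₂ (_ , glued) = cong paint glued
  ... | inj₁ (k , ck , refl , glued) with core-parent ck
  ...   | z , e =
    trans (cong paint glued) (trans (colour-preserved pZ′ pX f e) (sym (colour-preserved pZ′ pY g e)))

  f′ : Embedding X W
  f′ = Coloured.embedding Finₚ.+↔⊎ arc? paint X pX inj₁ Sumₚ.inj₁-injective arc-inj₁⇔ (λ _ → refl)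

  g′ : Embedding Y W
  g′ = Coloured.embedding Finₚ.+↔⊎ arc? paint Y pY glue glue-injective arc-glue⇔ paint-glue

  square-commutes : ∀ {k} → Core k → fun f′ (fun f k) ≡ fun g′ (fun g k)
  square-commutes ck = cong (Fin.join _ _) (sym (glue-core ck))

mainTheorem5 : WAP InP
mainTheorem5 Z pZ = Z′ , Z′-InP , embed , λ X Y pX pY f g →
  let open Amalgam Z′ Z′-InP core? (λ {k k′} → core-connected {k} {k′}) (λ {k} → core-parent {k}) pX pY f g
  in W , W-InP , f′ , g′ , λ z → square-commutes (embed-core z)
  where open Extension Z pZ
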